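{- Let $\sigma$ be a permutation and $k$ a non-negative integer. Then there exists a constant $c$ such that $|\mathsf{ASM}_{n,k}(\sigma)|\le c^n$ for all $n$.
   Context: An alternating sign matrix (ASM) is a square matrix with entries in $\{0,1,-1\}$ such that every row and every column sums to $1$ and the nonzero entries of each row and each column alternate in sign. A permutation $\pi\in S_m$ is identified with the $m\times m$ matrix whose row $i$ has a $1$ in column $\pi(i)$ and $0$ elsewhere. An $n\times n$ ASM $A$ classically contains $\pi\in S_m$ if there are order-preserving injections $f,g:[m]\to[n]$ with $A_{f(i),g(\pi(i))}=1$ for all $i$; otherwise $A$ classically avoids $\pi$. $\mathsf{ASM}_{n,k}(\sigma)$ denotes the set of $n\times n$ ASMs classically avoiding $\sigma$ and containing exactly $k$ entries equal to $-1$. -}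

module Defs where

open import Data.Nat using (ℕ; zero; suc; _+_)
open import Data.Integer using (ℤ; +_; -[1+_]; 0ℤ; 1ℤ) renaming (_+_ to _+ℤ_)
open import Data.Fin using (Fin; _<_)
open import Data.List using (List; []; _∷_; map; foldr; filter)
open import Data.Nat.ListAction using (sum)
open import Data.Vec.Functional using (toList)
open import Data.Product using (Σ; _×_; ∃; ∃-syntax)
open import Data.Empty using (⊥)
open import Data.Unit using (⊤)
open import Relation.Binary.PropositionalEquality using (_≡_; _≢_)
open import Function.Bundles using (_↔_; Inverse)

data Entry : Set where
  zer pos neg : Entry

val : Entry → ℤ
val zer = 0ℤ
val pos = 1ℤ
val neg = -[1+ 0 ]

-- n × n matrices with entries in {0,1,-1}; A i j = entry in row i, column j.
Matrix : ℕ → Set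
Matrix n = Fin n → Fin n → Entry

lineSum : ∀ {n} → (Fin n → Entry) → ℤ
lineSum v = foldr (λ e s → val e +ℤ s) 0ℤ (toList v)

nonzeros : List Entry → List Entry
nonzeros [] = []
nonzeros (zer ∷ es) = nonzeros es
nonzeros (pos ∷ es) = pos ∷ nonzeros es
nonzeros (neg ∷ es) = neg ∷ nonzeros es

Alternating : List Entry → Set
Alternating [] = ⊤
Alternating (x ∷ []) = ⊤
Alternating (x ∷ y ∷ es) = (x ≢ y) × Alternating (y ∷ es)

GoodLine : ∀ {n} → (Fin n → Entry) → Set
GoodLine v = (lineSum v ≡ 1ℤ) × Alternating (nonzeros (toList v))

IsASM : ∀ {n} → Matrix n → Set
IsASM {n} A = (∀ i → GoodLine (λ j → A i j)) × (∀ j → GoodLine (λ i → A i j))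

countNeg : ∀ {n} → Matrix n → ℕ
countNeg A = sum (map (λ i → sum (map (λ j → cnt (A i j)) (toList (λ j → j)))) (toList (λ i → i)))
  where
  cnt : Entry → ℕ
  cnt neg = 1
  cnt _ = 0

Perm : ℕ → Set
Perm m = Fin m ↔ Fin m

OrderPreserving : ∀ {m n} → (Fin m → Fin n) → Set
OrderPreserving f = ∀ {i j} → i < j → f i < f j

Contains : ∀ {n m} → Matrix n → Perm m → Set
Contains {n} {m} A π =
  Σ (Fin m → Fin n) λ f → Σ (Fin m → Fin n) λ g →
    OrderPreserving f × OrderPreserving g ×
    (∀ i → A (f i) (g (Inverse.to π i)) ≡ pos)

Avoids : ∀ {n m} → Matrix n → Perm m → Set
Avoids A π = Contains A π → ⊥

InASM : ∀ {m} (n k : ℕ) (σ : Perm m) → Matrix n → Set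
InASM n k σ A = IsASM A × Avoids A σ × (countNeg A ≡ k)

-- matrices differ in some entry (function equality is not decidable/extensional here)
DistinctMat : ∀ {n} → Matrix n → Matrix n → Set
DistinctMat A B = Σ _ λ i → Σ _ λ j → A i j ≢ B i j

-- The +1 entries of an ASM in ASM_{n,k}(σ) form a 0-1 matrix avoiding σ, and the ASM is
-- determined by it together with the positions of its k entries -1, for which there are at most
-- (n² + 1)^k ≤ 4^{nk} choices. It remains to bound the σ-avoiding 0-1 matrices exponentially (Klazar,
-- Marcus–Tardos). Let σ ∈ S_{p+1} and t = p² + 2, and pad an n × n matrix with zeros to size t^a ≤ t n.
-- Contracting t × t blocks maps avoiders of size t N to avoiders of size N, and two avoiders with the same
-- contraction B can only differ inside the blocks that are 1 in B; by Marcus–Tardos B has at most c N ones,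
-- so each fibre has at most 2^{c t² N} elements, and induction on a gives at most D^{t^a} avoiders.
-- Marcus–Tardos itself: call a block wide if more than p of its columns are occupied. p+1 wide blocks of
-- one block column occupying the same set of columns would contain σ, so each block column has at most
-- p 2^t wide blocks, and symmetrically for rows; the remaining nonzero blocks have at most p² ones each,
-- whence ones(t N) ≤ p² ones(N) + 2 t² N p 2^t, and the induction closes at c = t² (p+1) 2^t.

module Submission where

open import Defs
open import Data.Nat using (ℕ; zero; suc; _+_; _*_; _^_; _∸_; _≤_; _<_; z≤n; s≤s; _<ᵇ_; NonZero; >-nonZero)
open import Data.Nat.Properties
open import Data.Nat.ListAction using (sum)
open import Data.Nat.ListAction.Properties using (sum-++)
open import Data.Nat.Tactic.RingSolver using (solve-∀)
open import Data.Fin using (Fin; toℕ; fromℕ<) renaming (_<_ to _<ᶠ_)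
open import Data.Fin.Properties using (toℕ-fromℕ<; fromℕ<-toℕ; toℕ<n; toℕ-injective)
open import Data.Bool using (Bool; true; false; T; _∨_; if_then_else_)
open import Data.Bool.Properties using () renaming (_≟_ to _≟ᵇ_)
open import Data.Unit using (tt)
open import Data.List using (List; []; _∷_; _++_; length; filter; map; upTo; allFin; cartesianProduct)
open import Data.List.Properties using (length-++; length-map; length-upTo; length-tabulate; map-cong; map-++; map-∘)
open import Data.List.Membership.Propositional using (_∈_; find; lose)
open import Data.List.Membership.Propositional.Properties
  using (∈-++⁺ˡ; ∈-++⁺ʳ; ∈-upTo⁺; ∈-upTo⁻; ∈-allFin; ∈-cartesianProduct⁺; ∈-cartesianProduct⁻)
open import Data.List.Relation.Unary.All using (All; []; _∷_)
import Data.List.Relation.Unary.All as All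
open import Data.List.Relation.Unary.All.Properties using (all-filter; ¬All⇒Any¬)
import Data.List.Relation.Unary.All.Properties as All
open import Data.List.Relation.Unary.AllPairs using (AllPairs; []; _∷_)
import Data.List.Relation.Unary.AllPairs as AllPairs
import Data.List.Relation.Unary.AllPairs.Properties as AllPairs
open import Data.List.Relation.Unary.Any using (Any; here; there)
open import Data.Product using (Σ; _×_; _,_; proj₁; proj₂; ∃-syntax)
open import Data.Sum using (_⊎_; inj₁; inj₂)
open import Data.Empty using (⊥-elim)
open import Relation.Nullary using (¬_; yes; no)
open import Relation.Binary.PropositionalEquality
open import Function using (_∘_; id)
open import Function.Bundles using (Inverse)

bit : Bool → ℕ
bit true = 1
bit false = 0

bit≤1 : ∀ b → bit b ≤ 1
bit≤1 true = s≤s z≤n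
bit≤1 false = z≤n

sumBelow : ℕ → (ℕ → ℕ) → ℕ
sumBelow zero f = 0
sumBelow (suc n) f = f 0 + sumBelow n (f ∘ suc)

sumBelow-cong : ∀ n {f g : ℕ → ℕ} → (∀ i → i < n → f i ≡ g i) → sumBelow n f ≡ sumBelow n g
sumBelow-cong zero eq = refl
sumBelow-cong (suc n) eq = cong₂ _+_ (eq 0 (s≤s z≤n)) (sumBelow-cong n (λ i i<n → eq (suc i) (s≤s i<n)))

sumBelow-mono-≤ : ∀ n {f g : ℕ → ℕ} → (∀ i → i < n → f i ≤ g i) → sumBelow n f ≤ sumBelow n g
sumBelow-mono-≤ zero le = z≤n
sumBelow-mono-≤ (suc n) le = +-mono-≤ (le 0 (s≤s z≤n)) (sumBelow-mono-≤ n (λ i i<n → le (suc i) (s≤s i<n)))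

sumBelow-const : ∀ n c → sumBelow n (λ _ → c) ≡ n * c
sumBelow-const zero c = refl
sumBelow-const (suc n) c = cong (c +_) (sumBelow-const n c)

sumBelow-distrib-+ : ∀ n (f g : ℕ → ℕ) → sumBelow n (λ i → f i + g i) ≡ sumBelow n f + sumBelow n g
sumBelow-distrib-+ zero f g = refl
sumBelow-distrib-+ (suc n) f g rewrite sumBelow-distrib-+ n (f ∘ suc) (g ∘ suc) =
  interchange (f 0) (g 0) (sumBelow n (f ∘ suc)) (sumBelow n (g ∘ suc))
  where
  interchange : ∀ a b c d → a + b + (c + d) ≡ a + c + (b + d)
  interchange = solve-∀

sumBelow-*ˡ : ∀ n c (f : ℕ → ℕ) → sumBelow n (λ i → c * f i) ≡ c * sumBelow n f
sumBelow-*ˡ zero c f = sym (*-zeroʳ c)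
sumBelow-*ˡ (suc n) c f rewrite sumBelow-*ˡ n c (f ∘ suc) = sym (*-distribˡ-+ c (f 0) _)

sumBelow-*ʳ : ∀ n c (f : ℕ → ℕ) → sumBelow n (λ i → f i * c) ≡ sumBelow n f * c
sumBelow-*ʳ n c f = begin
  sumBelow n (λ i → f i * c)  ≡⟨ sumBelow-cong n (λ i _ → *-comm (f i) c) ⟩
  sumBelow n (λ i → c * f i)  ≡⟨ sumBelow-*ˡ n c f ⟩
  c * sumBelow n f            ≡⟨ *-comm c _ ⟩
  sumBelow n f * c            ∎
  where open ≡-Reasoning

sumBelow-+ : ∀ a b (f : ℕ → ℕ) → sumBelow (a + b) f ≡ sumBelow a f + sumBelow b (λ i → f (a + i))
sumBelow-+ zero b f = refl
sumBelow-+ (suc a) b f rewrite sumBelow-+ a b (f ∘ suc) = sym (+-assoc (f 0) _ _)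

sumBelow-* : ∀ N t (f : ℕ → ℕ) → sumBelow (N * t) f ≡ sumBelow N (λ I → sumBelow t (λ a → f (I * t + a)))
sumBelow-* zero t f = refl
sumBelow-* (suc N) t f = begin
  sumBelow (t + N * t) f
    ≡⟨ sumBelow-+ t (N * t) f ⟩
  sumBelow t f + sumBelow (N * t) (λ i → f (t + i))
    ≡⟨ cong (sumBelow t f +_) (sumBelow-* N t (λ i → f (t + i))) ⟩
  sumBelow t f + sumBelow N (λ I → sumBelow t (λ a → f (t + (I * t + a))))
    ≡⟨ cong (sumBelow t f +_) (sumBelow-cong N (λ I _ → sumBelow-cong t (λ a _ → cong f (sym (+-assoc t (I * t) a))))) ⟩
  sumBelow t f + sumBelow N (λ I → sumBelow t (λ a → f (suc I * t + a)))
    ∎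
  where open ≡-Reasoning

sumBelow-comm : ∀ n k (F : ℕ → ℕ → ℕ) →
  sumBelow n (λ a → sumBelow k (F a)) ≡ sumBelow k (λ b → sumBelow n (λ a → F a b))
sumBelow-comm zero k F = sym (trans (sumBelow-const k 0) (*-zeroʳ k))
sumBelow-comm (suc n) k F = begin
  sumBelow k (F 0) + sumBelow n (λ a → sumBelow k (F (suc a)))
    ≡⟨ cong (sumBelow k (F 0) +_) (sumBelow-comm n k (F ∘ suc)) ⟩
  sumBelow k (F 0) + sumBelow k (λ b → sumBelow n (λ a → F (suc a) b))
    ≡⟨ sumBelow-distrib-+ k (F 0) (λ b → sumBelow n (λ a → F (suc a) b)) ⟨
  sumBelow k (λ b → sumBelow (suc n) (λ a → F a b))
    ∎
  where open ≡-Reasoning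

sumBelow² : ℕ → (ℕ → ℕ → ℕ) → ℕ
sumBelow² N F = sumBelow N (λ I → sumBelow N (F I))

sumBelow²-mono-≤ : ∀ N {F G : ℕ → ℕ → ℕ} → (∀ I J → I < N → J < N → F I J ≤ G I J) → sumBelow² N F ≤ sumBelow² N G
sumBelow²-mono-≤ N le = sumBelow-mono-≤ N (λ I I<N → sumBelow-mono-≤ N (λ J J<N → le I J I<N J<N))

sumBelow²-distrib-+ : ∀ N (F G : ℕ → ℕ → ℕ) → sumBelow² N (λ I J → F I J + G I J) ≡ sumBelow² N F + sumBelow² N G
sumBelow²-distrib-+ N F G = trans (sumBelow-cong N (λ I _ → sumBelow-distrib-+ N (F I) (G I))) (sumBelow-distrib-+ N _ _)

sumBelow²-*ˡ : ∀ N c (F : ℕ → ℕ → ℕ) → sumBelow² N (λ I J → c * F I J) ≡ c * sumBelow² N F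
sumBelow²-*ˡ N c F = trans (sumBelow-cong N (λ I _ → sumBelow-*ˡ N c (F I))) (sumBelow-*ˡ N c _)

sumBelow-bit≤ : ∀ n (h : ℕ → Bool) → sumBelow n (bit ∘ h) ≤ n
sumBelow-bit≤ n h = begin
  sumBelow n (bit ∘ h)   ≤⟨ sumBelow-mono-≤ n (λ i _ → bit≤1 (h i)) ⟩
  sumBelow n (λ _ → 1)   ≡⟨ sumBelow-const n 1 ⟩
  n * 1                  ≡⟨ *-identityʳ n ⟩
  n                      ∎
  where open ≤-Reasoning

anyBelow : ℕ → (ℕ → Bool) → Bool
anyBelow zero h = false
anyBelow (suc n) h = h 0 ∨ anyBelow n (h ∘ suc)

anyBelow-intro : ∀ n (h : ℕ → Bool) {a} → a < n → h a ≡ true → anyBelow n h ≡ true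
anyBelow-intro (suc n) h {zero} _ ha rewrite ha = refl
anyBelow-intro (suc n) h {suc a} (s≤s a<n) ha with h 0
... | true = refl
... | false = anyBelow-intro n (h ∘ suc) a<n ha

anyBelow-elim : ∀ n (h : ℕ → Bool) → anyBelow n h ≡ true → ∃[ a ] a < n × h a ≡ true
anyBelow-elim (suc n) h any with h 0 in h0
... | true = 0 , s≤s z≤n , h0
... | false with anyBelow-elim n (h ∘ suc) any
...   | a , a<n , ha = suc a , s≤s a<n , ha

anyBelow-false : ∀ n (h : ℕ → Bool) → anyBelow n h ≡ false → ∀ {a} → a < n → h a ≡ false
anyBelow-false n h none {a} a<n with h a in ha
... | false = refl
... | true with () ← trans (sym (anyBelow-intro n h a<n ha)) none

block-< : ∀ t {I I' a} a' → I < I' → a < t → I * t + a < I' * t + a'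
block-< t {I} {I'} {a} a' I<I' a<t = begin-strict
  I * t + a    <⟨ +-monoʳ-< (I * t) a<t ⟩
  I * t + t    ≡⟨ +-comm (I * t) t ⟩
  suc I * t    ≤⟨ *-monoˡ-≤ t I<I' ⟩
  I' * t       ≤⟨ m≤m+n (I' * t) a' ⟩
  I' * t + a'  ∎
  where open ≤-Reasoning

block-decompose : ∀ N t {i} → i < N * t → ∃[ I ] ∃[ a ] I < N × a < t × i ≡ I * t + a
block-decompose (suc N) t {i} i<N*t with i <? t
... | yes i<t = 0 , i , s≤s z≤n , i<t , refl
... | no i≮t with block-decompose N t {i ∸ t} (subst (i ∸ t <_) (m+n∸m≡n t (N * t)) (∸-monoˡ-< i<N*t (≮⇒≥ i≮t)))
...   | I , a , I<N , a<t , eq = suc I , a , s≤s I<N , a<t , (begin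
  i                ≡⟨ m+[n∸m]≡n (≮⇒≥ i≮t) ⟨
  t + (i ∸ t)      ≡⟨ cong (t +_) eq ⟩
  t + (I * t + a)  ≡⟨ +-assoc t (I * t) a ⟨
  suc I * t + a    ∎)
  where open ≡-Reasoning

concatBelow : ∀ {X : Set} → ℕ → (ℕ → List X) → List X
concatBelow zero h = []
concatBelow (suc n) h = h 0 ++ concatBelow n (h ∘ suc)

length-concatBelow : ∀ {X : Set} n (h : ℕ → List X) → length (concatBelow n h) ≡ sumBelow n (length ∘ h)
length-concatBelow zero h = refl
length-concatBelow (suc n) h = trans (length-++ (h 0)) (cong (length (h 0) +_) (length-concatBelow n (h ∘ suc)))

∈-concatBelow⁺ : ∀ {X : Set} n (h : ℕ → List X) {a x} → a < n → x ∈ h a → x ∈ concatBelow n h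
∈-concatBelow⁺ (suc n) h {zero} _ x∈ = ∈-++⁺ˡ x∈
∈-concatBelow⁺ (suc n) h {suc a} (s≤s a<n) x∈ = ∈-++⁺ʳ (h 0) (∈-concatBelow⁺ n (h ∘ suc) a<n x∈)

AllPairs-mapWith : ∀ {X : Set} {P : X → Set} {R R' : X → X → Set} →
  (∀ {a b} → P a → P b → R a b → R' a b) → ∀ {xs} → All P xs → AllPairs R xs → AllPairs R' xs
AllPairs-mapWith f [] [] = []
AllPairs-mapWith f (px ∷ pxs) (rx ∷ rxs) =
  All.zipWith (λ (py , r) → f px py r) (pxs , rx) ∷ AllPairs-mapWith f pxs rxs

module _ {X : Set} (h : X → Bool) where

  select : Bool → List X → List X
  select b = filter (λ x → h x ≟ᵇ b)

  select-sound : ∀ b xs → All (λ x → h x ≡ b) (select b xs)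
  select-sound b = all-filter (λ x → h x ≟ᵇ b)

  select-All : ∀ {P : X → Set} b {xs} → All P xs → All (λ x → P x × h x ≡ b) (select b xs)
  select-All b {xs} pxs = All.zip (All.filter⁺ (λ x → h x ≟ᵇ b) pxs , select-sound b xs)

  select-AllPairs : ∀ {R : X → X → Set} b {xs} → AllPairs R xs → AllPairs R (select b xs)
  select-AllPairs b = AllPairs.filter⁺ (λ x → h x ≟ᵇ b)

  length-select : ∀ xs → length (select true xs) + length (select false xs) ≡ length xs
  length-select [] = refl
  length-select (x ∷ xs) with h x
  ... | true = cong suc (length-select xs)
  ... | false = trans (+-suc _ _) (cong suc (length-select xs))

-- Counting families of Boolean functions

-- ball L k = Σ_{i ≤ k} (L choose i), the number of subsets of size at most k of an L-element set.
ball : ℕ → ℕ → ℕ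
ball zero k = 1
ball (suc L) zero = ball L zero
ball (suc L) (suc k) = ball L (suc k) + ball L k

ball≤2^ : ∀ L k → ball L k ≤ 2 ^ L
ball≤2^ zero k = ≤-refl
ball≤2^ (suc L) zero = ≤-trans (ball≤2^ L zero) (m≤m+n (2 ^ L) _)
ball≤2^ (suc L) (suc k) = begin
  ball L (suc k) + ball L k  ≤⟨ +-mono-≤ (ball≤2^ L (suc k)) (ball≤2^ L k) ⟩
  2 ^ L + 2 ^ L              ≡⟨ cong (2 ^ L +_) (+-identityʳ (2 ^ L)) ⟨
  2 ^ suc L                  ∎
  where open ≤-Reasoning

ball≤suc^ : ∀ L k → ball L k ≤ suc L ^ k
ball≤suc^ zero k = ≤-reflexive (sym (^-zeroˡ k))
ball≤suc^ (suc L) zero = ball≤suc^ L zero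
ball≤suc^ (suc L) (suc k) = begin
  ball L (suc k) + ball L k    ≤⟨ +-mono-≤ (ball≤suc^ L (suc k)) (ball≤suc^ L k) ⟩
  suc L ^ suc k + suc L ^ k    ≡⟨ +-comm (suc L * suc L ^ k) _ ⟩
  suc (suc L) * suc L ^ k      ≤⟨ *-monoʳ-≤ (suc (suc L)) (^-monoˡ-≤ k (n≤1+n (suc L))) ⟩
  suc (suc L) ^ suc k          ∎
  where open ≤-Reasoning

module _ {A X : Set} (ev : A → X → Bool) where

  DifferOn : List X → A → A → Set
  DifferOn S F F' = Any (λ x → ev F x ≢ ev F' x) S

  AgreeOn : List X → A → A → Set
  AgreeOn S F F' = All (λ x → ev F x ≡ ev F' x) S

  agree-or-differ : ∀ S F F' → AgreeOn S F F' ⊎ DifferOn S F F'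
  agree-or-differ S F F' with All.all? (λ x → ev F x ≟ᵇ ev F' x) S
  ... | yes agree = inj₁ agree
  ... | no ¬agree = inj₂ (¬All⇒Any¬ (λ x → ev F x ≟ᵇ ev F' x) S ¬agree)

  trueCount : List X → A → ℕ
  trueCount S F = sum (map (bit ∘ ev F) S)

  trueCount≤length : ∀ S F → trueCount S F ≤ length S
  trueCount≤length [] F = z≤n
  trueCount≤length (x ∷ S) F = +-mono-≤ (bit≤1 (ev F x)) (trueCount≤length S F)

  -- Split the family by the value at the first position x; on each half x no longer separates anything.
  length≤ball : ∀ S k {Fs} → AllPairs (DifferOn S) Fs → All (λ F → trueCount S F ≤ k) Fs →
    length Fs ≤ ball (length S) k
  length≤ball [] k {[]} _ _ = z≤n
  length≤ball [] k {F ∷ []} _ _ = ≤-refl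
  length≤ball [] k {F ∷ F' ∷ Fs} ((() ∷ _) ∷ _) _
  length≤ball (x ∷ S) k {Fs} separated few =
    subst (_≤ ball (length (x ∷ S)) k) (length-select (λ F → ev F x) Fs) (halves k few)
    where
    part : Bool → List A
    part b = select (λ F → ev F x) b Fs

    separated-part : ∀ b → AllPairs (DifferOn S) (part b)
    separated-part b = AllPairs-mapWith separatedTail (select-sound (λ F → ev F x) b Fs)
                         (select-AllPairs (λ F → ev F x) b separated)
      where
      separatedTail : ∀ {F F'} → ev F x ≡ b → ev F' x ≡ b → DifferOn (x ∷ S) F F' → DifferOn S F F'
      separatedTail Fx F'x (here Fx≢F'x) = ⊥-elim (Fx≢F'x (trans Fx (sym F'x)))
      separatedTail _ _ (there d) = d

    few-part : ∀ {k} b → All (λ F → trueCount (x ∷ S) F ≤ k) Fs → All (λ F → bit b + trueCount S F ≤ k) (part b)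
    few-part b few = All.map (λ { (c≤k , refl) → c≤k }) (select-All (λ F → ev F x) b few)

    halves : ∀ k → All (λ F → trueCount (x ∷ S) F ≤ k) Fs → length (part true) + length (part false) ≤ ball (suc (length S)) k
    halves zero few with part true | few-part true few
    ... | [] | [] = length≤ball S zero (separated-part false) (few-part false few)
    ... | _ ∷ _ | () ∷ _
    halves (suc k) few = begin
      length (part true) + length (part false)
        ≡⟨ +-comm (length (part true)) _ ⟩
      length (part false) + length (part true)
        ≤⟨ +-mono-≤ (length≤ball S (suc k) (separated-part false) (few-part false few))
                    (length≤ball S k (separated-part true) (All.map ≤-pred (few-part true few))) ⟩
      ball (length S) (suc k) + ball (length S) k
        ∎
      where open ≤-Reasoning

  length≤2^ : ∀ S {Fs} → AllPairs (DifferOn S) Fs → length Fs ≤ 2 ^ length S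
  length≤2^ S {Fs} separated = ≤-trans
    (length≤ball S (length S) separated (All.universal (trueCount≤length S) Fs))
    (ball≤2^ (length S) (length S))

module Fibres {A : Set} (Distinct Same Apart : A → A → Set)
  (same-or-apart : ∀ a a' → Same a a' ⊎ Apart a a') (Same-refl : ∀ a → Same a a) where

  private
    isSame : A → A → Bool
    isSame a a' with same-or-apart a a'
    ... | inj₁ _ = true
    ... | inj₂ _ = false

    isSame-true : ∀ {a a'} → isSame a a' ≡ true → Same a a'
    isSame-true {a} {a'} eq with same-or-apart a a'
    ... | inj₁ same = same

    isSame-false : ∀ {a a'} → isSame a a' ≡ false → Apart a a'
    isSame-false {a} {a'} eq with same-or-apart a a'
    ... | inj₂ apart = apart

  length≤fibre*representatives : (Q : A → Set) (b : ℕ) →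
    (∀ {a₀} → Q a₀ → ∀ {Fs} → AllPairs Distinct Fs → All (λ F → Q F × Same a₀ F) Fs → length Fs ≤ b) →
    ∀ {P : A → Set} → (∀ {a} → P a → Q a) → ∀ {As} → AllPairs Distinct As → All P As →
    ∃[ reps ] AllPairs Apart reps × All P reps × length As ≤ b * length reps
  length≤fibre*representatives Q b fibre P⇒Q {As} = go (length As) P⇒Q ≤-refl
    where
    go : ∀ fuel {P : A → Set} → (∀ {a} → P a → Q a) → ∀ {As} → length As ≤ fuel →
      AllPairs Distinct As → All P As → ∃[ reps ] AllPairs Apart reps × All P reps × length As ≤ b * length reps
    go _ P⇒Q {[]} _ _ _ = [] , [] , [] , z≤n
    go (suc fuel) {P} P⇒Q {a ∷ As} (s≤s len≤) (a-distinct ∷ distinct) (pa ∷ ps) =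
      let reps , apart , preps , bound = go fuel (P⇒Q ∘ proj₁) others-length
            (select-AllPairs (isSame a) false distinct)
            (All.map (λ (px , e) → px , isSame-false e) (select-All (isSame a) false ps))
      in a ∷ reps , All.map proj₂ preps ∷ apart , pa ∷ All.map proj₁ preps , (begin
        suc (length As)                              ≡⟨ cong suc (length-select (isSame a) As) ⟨
        length (a ∷ fibre-of-a) + length others      ≤⟨ +-mono-≤ fibre-bound bound ⟩
        b + b * length reps                          ≡⟨ *-suc b (length reps) ⟨
        b * suc (length reps)                        ∎)
      where
      open ≤-Reasoning
      fibre-of-a others : List A
      fibre-of-a = select (isSame a) true As
      others = select (isSame a) false As
      others-length : length others ≤ fuel
      others-length = ≤-trans (subst (length others ≤_) (length-select (isSame a) As) (m≤n+m _ _)) len≤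
      fibre-bound : length (a ∷ fibre-of-a) ≤ b
      fibre-bound = fibre (P⇒Q pa)
        (All.filter⁺ (λ x → isSame a x ≟ᵇ true) a-distinct ∷ select-AllPairs (isSame a) true distinct)
        ((P⇒Q pa , Same-refl a) ∷ All.map (λ (px , e) → P⇒Q px , isSame-true e) (select-All (isSame a) true ps))

-- 0-1 matrices, patterns and contraction

BitMatrix : Set
BitMatrix = ℕ → ℕ → Bool

transpose : BitMatrix → BitMatrix
transpose M i j = M j i

entry : BitMatrix → ℕ × ℕ → Bool
entry M (i , j) = M i j

grid : ℕ → List (ℕ × ℕ)
grid L = cartesianProduct (upTo L) (upTo L)

∈-grid⁺ : ∀ {L i j} → i < L → j < L → (i , j) ∈ grid L
∈-grid⁺ i<L j<L = ∈-cartesianProduct⁺ (∈-upTo⁺ i<L) (∈-upTo⁺ j<L)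

∈-grid⁻ : ∀ {L i j} → (i , j) ∈ grid L → i < L × j < L
∈-grid⁻ {L} ij∈ with i∈ , j∈ ← ∈-cartesianProduct⁻ (upTo L) (upTo L) ij∈ = ∈-upTo⁻ i∈ , ∈-upTo⁻ j∈

DifferBelow : ℕ → BitMatrix → BitMatrix → Set
DifferBelow L = DifferOn entry (grid L)

length-cartesianProduct : ∀ {X Y : Set} (xs : List X) (ys : List Y) →
  length (cartesianProduct xs ys) ≡ length xs * length ys
length-cartesianProduct [] ys = refl
length-cartesianProduct (x ∷ xs) ys =
  trans (length-++ (map (x ,_) ys)) (cong₂ _+_ (length-map (x ,_) ys) (length-cartesianProduct xs ys))

module _ {m : ℕ} where

  StrictlyIncreasing : (Fin m → ℕ) → Set
  StrictlyIncreasing f = ∀ {i j} → i <ᶠ j → f i < f j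

  HasPattern : (Fin m → Fin m) → BitMatrix → Set
  HasPattern s M = ∃[ f ] ∃[ g ] StrictlyIncreasing f × StrictlyIncreasing g × (∀ i → M (f i) (g (s i)) ≡ true)

  module _ (σ : Perm m) where
    open Inverse σ using (to; from; strictlyInverseˡ; strictlyInverseʳ)

    HasPattern-transpose : ∀ M → HasPattern from (transpose M) → HasPattern to M
    HasPattern-transpose M (f , g , f↗ , g↗ , occ) =
      g , f , g↗ , f↗ , λ i → subst (λ k → M (g k) (f (to i)) ≡ true) (strictlyInverseʳ i) (occ (to i))

contract : ℕ → BitMatrix → BitMatrix
contract t M I J = anyBelow t (λ a → anyBelow t (λ b → M (I * t + a) (J * t + b)))

contract-intro : ∀ t M I J {a b} → a < t → b < t → M (I * t + a) (J * t + b) ≡ true → contract t M I J ≡ true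
contract-intro t M I J a<t b<t one = anyBelow-intro t _ a<t (anyBelow-intro t _ b<t one)

contract-elim : ∀ t M I J → contract t M I J ≡ true →
  ∃[ a ] ∃[ b ] a < t × b < t × M (I * t + a) (J * t + b) ≡ true
contract-elim t M I J block with anyBelow-elim t _ block
... | a , a<t , row with anyBelow-elim t _ row
...   | b , b<t , one = a , b , a<t , b<t , one

module _ {m : ℕ} (σ : Perm m) where
  open Inverse σ using (to; from; strictlyInverseˡ; strictlyInverseʳ)

  -- Each 1 of the contracted pattern is realised by a 1 inside its block; blocks are ordered like their indices.
  HasPattern-contract : ∀ t M → HasPattern to (contract t M) → HasPattern to M
  HasPattern-contract t M (f , g , f↗ , g↗ , occ) = f' , g' , f'↗ , g'↗ , occ'
    where
    inBlock : ∀ i → ∃[ a ] ∃[ b ] a < t × b < t × M (f i * t + a) (g (to i) * t + b) ≡ true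
    inBlock i = contract-elim t M (f i) (g (to i)) (occ i)
    a b : Fin m → ℕ
    a i = proj₁ (inBlock i)
    b i = proj₁ (proj₂ (inBlock i))
    f' g' : Fin m → ℕ
    f' i = f i * t + a i
    g' j = g (to (from j)) * t + b (from j)
    f'↗ : StrictlyIncreasing f'
    f'↗ {i} i<j = block-< t _ (f↗ i<j) (proj₁ (proj₂ (proj₂ (inBlock i))))
    g'↗ : StrictlyIncreasing g'
    g'↗ {i} {j} i<j = block-< t _
      (subst₂ (λ x y → g x < g y) (sym (strictlyInverseˡ i)) (sym (strictlyInverseˡ j)) (g↗ i<j))
      (proj₁ (proj₂ (proj₂ (proj₂ (inBlock (from i))))))
    occ' : ∀ i → M (f' i) (g' (to i)) ≡ true
    occ' i = subst (λ k → M (f i * t + a i) (g (to k) * t + b k) ≡ true) (sym (strictlyInverseʳ i))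
               (proj₂ (proj₂ (proj₂ (proj₂ (inBlock i)))))

truesFrom : ℕ → (ℕ → Bool) → ℕ → List ℕ
truesFrom zero h k = []
truesFrom (suc n) h k with h k
... | true = k ∷ truesFrom n h (suc k)
... | false = truesFrom n h (suc k)

truesFrom-All : ∀ n h k → All (λ x → k ≤ x × x < k + n × h x ≡ true) (truesFrom n h k)
truesFrom-All zero h k = []
truesFrom-All (suc n) h k = extend (truesFrom-All n h (suc k))
  where
  widen : ∀ {x} → suc k ≤ x × x < suc k + n × h x ≡ true → k ≤ x × x < k + suc n × h x ≡ true
  widen {x} (k<x , x< , hx) = <⇒≤ k<x , subst (x <_) (sym (+-suc k n)) x< , hx
  extend : All (λ x → suc k ≤ x × x < suc k + n × h x ≡ true) (truesFrom n h (suc k)) →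
    All (λ x → k ≤ x × x < k + suc n × h x ≡ true) (truesFrom (suc n) h k)
  extend rest with h k in hk
  ... | true = (≤-refl , subst (k <_) (sym (+-suc k n)) (s≤s (m≤m+n k n)) , hk) ∷ All.map widen rest
  ... | false = All.map widen rest

truesFrom-sorted : ∀ n h k → AllPairs _<_ (truesFrom n h k)
truesFrom-sorted zero h k = []
truesFrom-sorted (suc n) h k with h k
... | true = All.map proj₁ (truesFrom-All n h (suc k)) ∷ truesFrom-sorted n h (suc k)
... | false = truesFrom-sorted n h (suc k)

length-truesFrom-suc : ∀ n h k → length (truesFrom (suc n) h k) ≡ bit (h k) + length (truesFrom n h (suc k))
length-truesFrom-suc n h k with h k
... | true = refl
... | false = refl

length-truesFrom : ∀ n h k → length (truesFrom n h k) ≡ sumBelow n (λ i → bit (h (k + i)))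
length-truesFrom zero h k = refl
length-truesFrom (suc n) h k = begin
  length (truesFrom (suc n) h k)
    ≡⟨ length-truesFrom-suc n h k ⟩
  bit (h k) + length (truesFrom n h (suc k))
    ≡⟨ cong₂ _+_ (cong (bit ∘ h) (sym (+-identityʳ k))) (length-truesFrom n h (suc k)) ⟩
  bit (h (k + 0)) + sumBelow n (λ i → bit (h (suc k + i)))
    ≡⟨ cong (bit (h (k + 0)) +_) (sumBelow-cong n (λ i _ → cong (bit ∘ h) (sym (+-suc k i)))) ⟩
  bit (h (k + 0)) + sumBelow n (λ i → bit (h (k + suc i)))
    ∎
  where open ≡-Reasoning

nth : List ℕ → ℕ → ℕ
nth [] _ = 0
nth (x ∷ xs) zero = x
nth (x ∷ xs) (suc i) = nth xs i

nth-All : ∀ {P : ℕ → Set} {xs} i → All P xs → i < length xs → P (nth xs i)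
nth-All zero (px ∷ _) _ = px
nth-All (suc i) (_ ∷ pxs) (s≤s i<len) = nth-All i pxs i<len

nth-sorted : ∀ {xs i j} → AllPairs _<_ xs → i < j → j < length xs → nth xs i < nth xs j
nth-sorted {x ∷ xs} {zero} {suc j} (x<xs ∷ _) _ (s≤s j<len) = nth-All j x<xs j<len
nth-sorted {x ∷ xs} {suc i} {suc j} (_ ∷ sorted) (s≤s i<j) (s≤s j<len) = nth-sorted sorted i<j j<len

-- The Marcus–Tardos theorem

ones : ℕ → BitMatrix → ℕ
ones n M = sumBelow² n (λ i j → bit (M i j))

module MarcusTardos (p : ℕ) where

  t : ℕ
  t = suc (suc (p * p))

  blockOnes : BitMatrix → ℕ → ℕ → ℕ
  blockOnes M I J = sumBelow t (λ a → sumBelow t (λ b → bit (M (I * t + a) (J * t + b))))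

  ones-blocks : ∀ N M → ones (N * t) M ≡ sumBelow² N (blockOnes M)
  ones-blocks N M = trans (sumBelow-* N t _)
    (sumBelow-cong N (λ I _ → trans (sumBelow-cong t (λ a _ → sumBelow-* N t (λ j → bit (M (I * t + a) j))))
                                    (sumBelow-comm t N (λ a J → sumBelow t (λ b → bit (M (I * t + a) (J * t + b)))))))

  columnOccupied : BitMatrix → ℕ → ℕ → ℕ → Bool
  columnOccupied M I J b = anyBelow t (λ a → M (I * t + a) (J * t + b))

  occupiedColumns : BitMatrix → ℕ → ℕ → ℕ
  occupiedColumns M I J = sumBelow t (bit ∘ columnOccupied M I J)

  wide : BitMatrix → ℕ → ℕ → Bool
  wide M I J = p <ᵇ occupiedColumns M I J

  wide-true : ∀ M I J → wide M I J ≡ true → p < occupiedColumns M I J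
  wide-true M I J w = <ᵇ⇒< p _ (subst T (sym w) tt)

  wide-false : ∀ M I J → wide M I J ≡ false → occupiedColumns M I J ≤ p
  wide-false M I J w = ≮⇒≥ (λ p< → subst T w (<⇒<ᵇ p<))

  module _ (s : Fin (suc p) → Fin (suc p)) (M : BitMatrix) (J : ℕ) where

    columnsOf : ℕ → ℕ → Bool
    columnsOf I = columnOccupied M I J

    -- A wide block I₀ supplies p+1 occupied columns, and p+1 blocks of the column occupying the same columns one row each.
    wide-blocks-pattern : ∀ I₀ {ys} → wide M I₀ J ≡ true → AllPairs _<_ ys →
      All (AgreeOn columnsOf (upTo t) I₀) ys → suc p ≤ length ys → HasPattern s M
    wide-blocks-pattern I₀ {ys} wideI₀ sorted agree p<len = f , g , f↗ , g↗ , occ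
      where
      cols : List ℕ
      cols = truesFrom t (columnsOf I₀) 0
      p<cols : suc p ≤ length cols
      p<cols = subst (suc p ≤_) (sym (length-truesFrom t (columnsOf I₀) 0)) (wide-true M I₀ J wideI₀)
      row col : Fin (suc p) → ℕ
      row i = nth ys (toℕ i)
      col j = nth cols (toℕ j)
      col-occupied : ∀ j → 0 ≤ col j × col j < t × columnsOf I₀ (col j) ≡ true
      col-occupied j = nth-All (toℕ j) (truesFrom-All t (columnsOf I₀) 0) (≤-trans (toℕ<n j) p<cols)
      occupied : ∀ i → columnsOf (row i) (col (s i)) ≡ true
      occupied i = let (_ , col<t , occ₀) = col-occupied (s i) in
        trans (sym (All.lookup (nth-All (toℕ i) agree (≤-trans (toℕ<n i) p<len)) (∈-upTo⁺ col<t))) occ₀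
      inBlock : ∀ i → ∃[ a ] a < t × M (row i * t + a) (J * t + col (s i)) ≡ true
      inBlock i = anyBelow-elim t _ (occupied i)
      f g : Fin (suc p) → ℕ
      f i = row i * t + proj₁ (inBlock i)
      g j = J * t + col j
      f↗ : StrictlyIncreasing f
      f↗ {i} {j} i<j = block-< t _ (nth-sorted sorted i<j (≤-trans (toℕ<n j) p<len)) (proj₁ (proj₂ (inBlock i)))
      g↗ : StrictlyIncreasing g
      g↗ {i} {j} i<j = +-monoʳ-< (J * t) (nth-sorted (truesFrom-sorted t (columnsOf I₀) 0) i<j (≤-trans (toℕ<n j) p<cols))
      occ : ∀ i → M (f i) (g (s i)) ≡ true
      occ i = proj₂ (proj₂ (inBlock i))

    -- Wide blocks of a block column are grouped by their set of occupied columns: each group has at most p members.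
    wide-blocks≤ : ¬ HasPattern s M → ∀ N → sumBelow N (λ I → bit (wide M I J)) ≤ p * 2 ^ t
    wide-blocks≤ avoid N
      with Fibres.length≤fibre*representatives _<_ (AgreeOn columnsOf (upTo t)) (DifferOn columnsOf (upTo t))
             (agree-or-differ columnsOf (upTo t)) (λ I → All.universal (λ _ → refl) (upTo t))
             (λ I → wide M I J ≡ true) p (λ {I₀} → fibre {I₀}) id
             (truesFrom-sorted N (λ I → wide M I J) 0) (All.map (proj₂ ∘ proj₂) (truesFrom-All N (λ I → wide M I J) 0))
      where
      fibre : ∀ {I₀} → wide M I₀ J ≡ true → ∀ {ys} → AllPairs _<_ ys →
        All (λ I → wide M I J ≡ true × AgreeOn columnsOf (upTo t) I₀ I) ys → length ys ≤ p
      fibre {I₀} wideI₀ sorted agree = ≮⇒≥ (λ p<len → avoid (wide-blocks-pattern I₀ wideI₀ sorted (All.map proj₂ agree) p<len))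
    ... | reps , apart , _ , bound = begin
      sumBelow N (λ I → bit (wide M I J))        ≡⟨ length-truesFrom N (λ I → wide M I J) 0 ⟨
      length (truesFrom N (λ I → wide M I J) 0)  ≤⟨ bound ⟩
      p * length reps                            ≤⟨ *-monoʳ-≤ p (length≤2^ columnsOf (upTo t) apart) ⟩
      p * 2 ^ length (upTo t)                    ≡⟨ cong (λ l → p * 2 ^ l) (length-upTo t) ⟩
      p * 2 ^ t                                  ∎
      where open ≤-Reasoning

  blockOnes≤t*t : ∀ M I J → blockOnes M I J ≤ t * t
  blockOnes≤t*t M I J = begin
    blockOnes M I J        ≤⟨ sumBelow-mono-≤ t (λ a _ → sumBelow-bit≤ t (λ b → M (I * t + a) (J * t + b))) ⟩
    sumBelow t (λ _ → t)   ≡⟨ sumBelow-const t t ⟩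
    t * t                  ∎
    where open ≤-Reasoning

  blockOnes≤rows*columns : ∀ M I J → blockOnes M I J ≤ occupiedColumns (transpose M) J I * occupiedColumns M I J
  blockOnes≤rows*columns M I J = begin
    blockOnes M I J
      ≤⟨ sumBelow-mono-≤ t (λ a a<t → sumBelow-mono-≤ t (λ b b<t → one≤row*column a b a<t b<t)) ⟩
    sumBelow t (λ a → sumBelow t (λ b → bit (rowOccupied a) * bit (columnOccupied M I J b)))
      ≡⟨ sumBelow-cong t (λ a _ → sumBelow-*ˡ t (bit (rowOccupied a)) (bit ∘ columnOccupied M I J)) ⟩
    sumBelow t (λ a → bit (rowOccupied a) * occupiedColumns M I J)
      ≡⟨ sumBelow-*ʳ t (occupiedColumns M I J) (bit ∘ rowOccupied) ⟩
    occupiedColumns (transpose M) J I * occupiedColumns M I J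
      ∎
    where
    open ≤-Reasoning
    rowOccupied : ℕ → Bool
    rowOccupied = columnOccupied (transpose M) J I
    one≤row*column : ∀ a b → a < t → b < t →
      bit (M (I * t + a) (J * t + b)) ≤ bit (rowOccupied a) * bit (columnOccupied M I J b)
    one≤row*column a b a<t b<t with M (I * t + a) (J * t + b) in one
    ... | false = z≤n
    ... | true rewrite anyBelow-intro t (λ b → M (I * t + a) (J * t + b)) b<t one
                     | anyBelow-intro t (λ a → M (I * t + a) (J * t + b)) a<t one = ≤-refl

  blockOnes≤0 : ∀ M I J → contract t M I J ≡ false → blockOnes M I J ≤ 0
  blockOnes≤0 M I J empty = begin
    blockOnes M I J        ≤⟨ sumBelow-mono-≤ t (λ a a<t → sumBelow-mono-≤ t (λ b b<t → ≤-reflexive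
                                (cong bit (anyBelow-false t (λ b → M (I * t + a) (J * t + b))
                                  (anyBelow-false t (λ a → anyBelow t (λ b → M (I * t + a) (J * t + b))) empty a<t) b<t)))) ⟩
    sumBelow t (λ _ → sumBelow t (λ _ → 0))
                           ≡⟨ sumBelow-cong t (λ _ _ → trans (sumBelow-const t 0) (*-zeroʳ t)) ⟩
    sumBelow t (λ _ → 0)   ≡⟨ trans (sumBelow-const t 0) (*-zeroʳ t) ⟩
    0                      ∎
    where open ≤-Reasoning

  -- A block that is neither wide nor tall has at most p occupied rows and p occupied columns.
  blockOnes≤ : ∀ M I J →
    blockOnes M I J ≤ p * p * bit (contract t M I J) + t * t * (bit (wide M I J) + bit (wide (transpose M) J I))
  blockOnes≤ M I J with wide M I J in w | wide (transpose M) J I in w'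
  ... | true | _ = ≤-trans (blockOnes≤t*t M I J) (≤-trans (m≤m*n (t * t) (suc _)) (m≤n+m _ _))
  ... | false | true = ≤-trans (blockOnes≤t*t M I J) (≤-trans (m≤m*n (t * t) 1) (m≤n+m _ _))
  ... | false | false with contract t M I J in nonempty
  ...   | false = ≤-trans (blockOnes≤0 M I J nonempty) z≤n
  ...   | true = begin
    blockOnes M I J                                      ≤⟨ blockOnes≤rows*columns M I J ⟩
    occupiedColumns (transpose M) J I * occupiedColumns M I J
                                                         ≤⟨ *-mono-≤ (wide-false (transpose M) J I w') (wide-false M I J w) ⟩
    p * p                                                ≡⟨ *-identityʳ (p * p) ⟨
    p * p * 1                                            ≤⟨ m≤m+n (p * p * 1) _ ⟩
    p * p * 1 + t * t * 0                                ∎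
    where open ≤-Reasoning

  module _ (σ : Perm (suc p)) where
    open Inverse σ using (to; from)

    ones≤contracted : ∀ N M → ¬ HasPattern to M →
      ones (N * t) M ≤ p * p * ones N (contract t M) + t * t * (N * (p * 2 ^ t) + N * (p * 2 ^ t))
    ones≤contracted N M avoid = begin
      ones (N * t) M
        ≡⟨ ones-blocks N M ⟩
      sumBelow² N (blockOnes M)
        ≤⟨ sumBelow²-mono-≤ N (λ I J _ _ → blockOnes≤ M I J) ⟩
      sumBelow² N (λ I J → p * p * contracted I J + t * t * (wideBit I J + tallBit I J))
        ≡⟨ sumBelow²-distrib-+ N _ _ ⟩
      sumBelow² N (λ I J → p * p * contracted I J) + sumBelow² N (λ I J → t * t * (wideBit I J + tallBit I J))
        ≡⟨ cong₂ _+_ (sumBelow²-*ˡ N (p * p) contracted)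
                     (trans (sumBelow²-*ˡ N (t * t) _) (cong (t * t *_) (sumBelow²-distrib-+ N wideBit tallBit))) ⟩
      p * p * ones N (contract t M) + t * t * (sumBelow² N wideBit + sumBelow² N tallBit)
        ≤⟨ +-monoʳ-≤ (p * p * ones N (contract t M)) (*-monoʳ-≤ (t * t) (+-mono-≤ wide≤ tall≤)) ⟩
      p * p * ones N (contract t M) + t * t * (N * (p * 2 ^ t) + N * (p * 2 ^ t))
        ∎
      where
      open ≤-Reasoning
      contracted wideBit tallBit : ℕ → ℕ → ℕ
      contracted I J = bit (contract t M I J)
      wideBit I J = bit (wide M I J)
      tallBit I J = bit (wide (transpose M) J I)
      wide≤ : sumBelow² N wideBit ≤ N * (p * 2 ^ t)
      wide≤ = begin
        sumBelow² N wideBit                                   ≡⟨ sumBelow-comm N N wideBit ⟩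
        sumBelow N (λ J → sumBelow N (λ I → wideBit I J))     ≤⟨ sumBelow-mono-≤ N (λ J _ → wide-blocks≤ to M J avoid N) ⟩
        sumBelow N (λ _ → p * 2 ^ t)                          ≡⟨ sumBelow-const N _ ⟩
        N * (p * 2 ^ t)                                       ∎
      tall≤ : sumBelow² N tallBit ≤ N * (p * 2 ^ t)
      tall≤ = begin
        sumBelow² N tallBit           ≤⟨ sumBelow-mono-≤ N (λ I _ →
                                           wide-blocks≤ from (transpose M) I (avoid ∘ HasPattern-transpose σ M) N) ⟩
        sumBelow N (λ _ → p * 2 ^ t)  ≡⟨ sumBelow-const N _ ⟩
        N * (p * 2 ^ t)               ∎

  density : ℕ
  density = t * t * suc p * 2 ^ t

  1≤density : 1 ≤ density
  1≤density = *-mono-≤ {1} {t * t * suc p} (*-mono-≤ {1} {t * t} (*-mono-≤ {1} {t} {1} {t} (s≤s z≤n) (s≤s z≤n)) (s≤s z≤n)) (m^n>0 2 t)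

  -- t = p² + 2 is what makes the recursion close: the p² from the contraction plus the two wide/tall terms.
  density-step : ∀ N X → X ≤ density * N →
    p * p * X + t * t * (N * (p * 2 ^ t) + N * (p * 2 ^ t)) ≤ density * (t * N)
  density-step N X X≤ = begin
    p * p * X + t * t * (N * (p * 2 ^ t) + N * (p * 2 ^ t))
      ≤⟨ +-mono-≤ (*-monoʳ-≤ (p * p) X≤) (≤-reflexive (regroup t p (2 ^ t) N)) ⟩
    p * p * (density * N) + 2 * (t * t * p * 2 ^ t * N)
      ≤⟨ +-monoʳ-≤ (p * p * (density * N))
           (*-monoʳ-≤ 2 (*-monoˡ-≤ N (*-monoˡ-≤ (2 ^ t) (*-monoʳ-≤ (t * t) (n≤1+n p))))) ⟩
    p * p * (density * N) + 2 * (density * N)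
      ≡⟨ factor density p N ⟨
    density * (t * N)
      ∎
    where
    open ≤-Reasoning
    regroup : ∀ t p E N → t * t * (N * (p * E) + N * (p * E)) ≡ 2 * (t * t * p * E * N)
    regroup = solve-∀
    factor : ∀ c p N → c * ((2 + p * p) * N) ≡ p * p * (c * N) + 2 * (c * N)
    factor = solve-∀

  ones≤density : (σ : Perm (suc p)) → ∀ a M → ¬ HasPattern (Inverse.to σ) M → ones (t ^ a) M ≤ density * t ^ a
  ones≤density σ zero M avoid = begin
    bit (M 0 0) + 0 + 0  ≡⟨ trans (+-identityʳ _) (+-identityʳ _) ⟩
    bit (M 0 0)          ≤⟨ ≤-trans (bit≤1 (M 0 0)) 1≤density ⟩
    density              ≡⟨ *-identityʳ density ⟨
    density * 1          ∎
    where open ≤-Reasoning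
  ones≤density σ (suc a) M avoid = begin
    ones (t * t ^ a) M  ≡⟨ cong (λ n → ones n M) (*-comm t (t ^ a)) ⟩
    ones (t ^ a * t) M  ≤⟨ ones≤contracted σ (t ^ a) M avoid ⟩
    p * p * ones (t ^ a) (contract t M) + t * t * (t ^ a * (p * 2 ^ t) + t ^ a * (p * 2 ^ t))
                        ≤⟨ density-step (t ^ a) _
                             (ones≤density σ a (contract t M) (avoid ∘ HasPattern-contract σ t M)) ⟩
    density * (t * t ^ a) ∎
    where open ≤-Reasoning

-- Klazar's bound

module Klazar (p : ℕ) (σ : Perm (suc p)) where
  open MarcusTardos p
  open Inverse σ using (to)

  blockRow : ℕ → ℕ → ℕ → List (ℕ × ℕ)
  blockRow I J a = concatBelow t (λ b → (I * t + a , J * t + b) ∷ [])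

  blockPositions : ℕ → ℕ → List (ℕ × ℕ)
  blockPositions I J = concatBelow t (blockRow I J)

  support : ℕ → BitMatrix → List (ℕ × ℕ)
  support N B = concatBelow N (λ I → concatBelow N (λ J → if B I J then blockPositions I J else []))

  length-blockRow : ∀ I J a → length (blockRow I J a) ≡ t * 1
  length-blockRow I J a = trans (length-concatBelow t (λ b → (I * t + a , J * t + b) ∷ [])) (sumBelow-const t 1)

  length-blockPositions : ∀ I J → length (blockPositions I J) ≡ t * t
  length-blockPositions I J = begin
    length (blockPositions I J)         ≡⟨ length-concatBelow t (blockRow I J) ⟩
    sumBelow t (length ∘ blockRow I J)  ≡⟨ sumBelow-cong t (λ a _ → length-blockRow I J a) ⟩
    sumBelow t (λ _ → t * 1)            ≡⟨ sumBelow-const t (t * 1) ⟩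
    t * (t * 1)                         ≡⟨ cong (t *_) (*-identityʳ t) ⟩
    t * t                               ∎
    where open ≡-Reasoning

  length-support : ∀ N B → length (support N B) ≤ ones N B * (t * t)
  length-support N B = begin
    length (support N B)
      ≡⟨ trans (length-concatBelow N _) (sumBelow-cong N (λ I _ → length-concatBelow N _)) ⟩
    sumBelow² N (λ I J → length (if B I J then blockPositions I J else []))
      ≤⟨ sumBelow²-mono-≤ N (λ I J _ _ → block≤ I J) ⟩
    sumBelow² N (λ I J → bit (B I J) * (t * t))
      ≡⟨ trans (sumBelow-cong N (λ I _ → sumBelow-*ʳ N (t * t) _)) (sumBelow-*ʳ N (t * t) _) ⟩
    ones N B * (t * t)
      ∎
    where
    open ≤-Reasoning
    block≤ : ∀ I J → length (if B I J then blockPositions I J else []) ≤ bit (B I J) * (t * t)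
    block≤ I J with B I J
    ... | true = ≤-reflexive (trans (length-blockPositions I J) (sym (+-identityʳ _)))
    ... | false = z≤n

  ∈-support : ∀ N B {I J a b} → I < N → J < N → a < t → b < t → B I J ≡ true →
    (I * t + a , J * t + b) ∈ support N B
  ∈-support N B {I} {J} {a} {b} I<N J<N a<t b<t BIJ =
    ∈-concatBelow⁺ N _ I<N (∈-concatBelow⁺ N _ J<N (subst (λ x → _ ∈ (if x then blockPositions I J else [])) (sym BIJ)
      (∈-concatBelow⁺ t (blockRow I J) a<t
        (∈-concatBelow⁺ t (λ b → (I * t + a , J * t + b) ∷ []) b<t (here refl)))))

  SameContraction : ℕ → BitMatrix → BitMatrix → Set
  SameContraction N = AgreeOn (entry ∘ contract t) (grid N)

  one∈support : ∀ N M₀ M {i j} → SameContraction N M₀ M → i < t * N → j < t * N → M i j ≡ true →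
    (i , j) ∈ support N (contract t M₀)
  one∈support N M₀ M {i} {j} same i< j< Mij
    with block-decompose N t (subst (i <_) (*-comm t N) i<) | block-decompose N t (subst (j <_) (*-comm t N) j<)
  ... | I , a , I<N , a<t , refl | J , b , J<N , b<t , refl =
    ∈-support N (contract t M₀) I<N J<N a<t b<t
      (trans (All.lookup same (∈-grid⁺ I<N J<N)) (contract-intro t M I J a<t b<t Mij))

  -- A difference between two matrices with the same contraction is a 1 of one of them, hence in the support.
  differ-on-support : ∀ N M₀ {M M'} → SameContraction N M₀ M → SameContraction N M₀ M' →
    DifferBelow (t * N) M M' → DifferOn entry (support N (contract t M₀)) M M'
  differ-on-support N M₀ {M} {M'} same same' differ with find differ
  ... | (i , j) , ij∈ , Mij≢M'ij with ∈-grid⁻ ij∈ | M i j in Mij | M' i j in M'ij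
  ...   | i< , j< | true | _ = lose (one∈support N M₀ M same i< j< Mij) Mij≢M'ij
  ...   | i< , j< | false | true = lose (one∈support N M₀ M' same' i< j< M'ij) Mij≢M'ij
  ...   | _ | false | false = ⊥-elim (Mij≢M'ij (trans Mij (sym M'ij)))

  D : ℕ
  D = 2 ^ (t * t * density)

  instance
    D-nonZero : NonZero D
    D-nonZero = >-nonZero (m^n>0 2 (t * t * density))

  2≤D : 2 ≤ D
  2≤D = ^-monoʳ-≤ 2 (*-mono-≤ {1} {t * t} (*-mono-≤ {1} {t} {1} {t} (s≤s z≤n) (s≤s z≤n)) 1≤density)

  Avoider : BitMatrix → Set
  Avoider M = ¬ HasPattern to M

  fibre≤ : ∀ a {M₀} → Avoider M₀ → ∀ {Fs} → AllPairs (DifferBelow (t * t ^ a)) Fs →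
    All (λ F → Avoider F × SameContraction (t ^ a) M₀ F) Fs → length Fs ≤ D ^ t ^ a
  fibre≤ a {M₀} avoid {Fs} differ same = begin
    length Fs                                          ≤⟨ length≤2^ entry (support N B) differ-on-B ⟩
    2 ^ length (support N B)                           ≤⟨ ^-monoʳ-≤ 2 (length-support N B) ⟩
    2 ^ (ones N B * (t * t))                           ≤⟨ ^-monoʳ-≤ 2 (*-monoˡ-≤ (t * t) few-blocks) ⟩
    2 ^ (density * N * (t * t))                        ≡⟨ cong (2 ^_) (reorder density N (t * t)) ⟩
    2 ^ (t * t * density * N)                          ≡⟨ ^-*-assoc 2 (t * t * density) N ⟨
    D ^ N                                              ∎
    where
    open ≤-Reasoning
    N = t ^ a
    B = contract t M₀
    differ-on-B : AllPairs (DifferOn entry (support N B)) Fs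
    differ-on-B = AllPairs-mapWith (λ (_ , s) (_ , s') → differ-on-support N M₀ s s') same differ
    few-blocks : ones N B ≤ density * N
    few-blocks = ones≤density σ a B (avoid ∘ HasPattern-contract σ t M₀)
    reorder : ∀ c N s → c * N * s ≡ s * c * N
    reorder = solve-∀

  -- Klazar: group the avoiders of size tN by their contraction, itself an avoider of size N.
  avoiders≤ : ∀ a {Ms} → AllPairs (DifferBelow (t ^ a)) Ms → All Avoider Ms → length Ms ≤ D ^ t ^ a
  avoiders≤ zero {Ms} differ _ = begin
    length Ms   ≤⟨ length≤2^ entry (grid 1) differ ⟩
    2           ≤⟨ 2≤D ⟩
    D           ≡⟨ *-identityʳ D ⟨
    D ^ 1       ∎
    where open ≤-Reasoning
  avoiders≤ (suc a) {Ms} differ avoid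
    with Fibres.length≤fibre*representatives (DifferBelow (t ^ suc a)) (SameContraction N)
           (DifferOn (entry ∘ contract t) (grid N)) (agree-or-differ (entry ∘ contract t) (grid N))
           (λ M → All.universal (λ _ → refl) (grid N)) Avoider (D ^ N) (λ {M₀} → fibre≤ a {M₀}) id differ avoid
    where N = t ^ a
  ... | reps , apart , avoid-reps , bound = begin
    length Ms                       ≤⟨ bound ⟩
    D ^ N * length reps             ≤⟨ *-monoʳ-≤ (D ^ N) reps≤ ⟩
    D ^ N * D ^ N                   ≡⟨ ^-distribˡ-+-* D N N ⟨
    D ^ (N + N)                     ≡⟨ cong (λ k → D ^ (N + k)) (+-identityʳ N) ⟨
    D ^ (2 * N)                     ≤⟨ ^-monoʳ-≤ D (*-monoˡ-≤ N {2} {t} (s≤s (s≤s z≤n))) ⟩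
    D ^ (t * N)                     ∎
    where
    open ≤-Reasoning
    N = t ^ a
    reps≤ : length reps ≤ D ^ N
    reps≤ = subst (_≤ D ^ N) (length-map (contract t) reps)
      (avoiders≤ a (AllPairs.map⁺ apart) (All.map⁺ (All.map (λ {M} av → av ∘ HasPattern-contract σ t M) avoid-reps)))

-- Alternating sign matrices

isPos isNeg : Entry → Bool
isPos pos = true
isPos _ = false
isNeg neg = true
isNeg _ = false

isPos-true : ∀ {e} → isPos e ≡ true → e ≡ pos
isPos-true {pos} _ = refl

-- An entry is determined by whether it is +1 and whether it is -1.
isNeg-separates : ∀ {e e'} → e ≢ e' → isPos e ≡ isPos e' → isNeg e ≢ isNeg e'
isNeg-separates {zer} {zer} e≢e' _ _ = e≢e' refl
isNeg-separates {pos} {pos} e≢e' _ _ = e≢e' refl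
isNeg-separates {neg} {neg} e≢e' _ _ = e≢e' refl
isNeg-separates {zer} {neg} _ _ ()
isNeg-separates {neg} {zer} _ _ ()
isNeg-separates {zer} {pos} _ ()
isNeg-separates {pos} {zer} _ ()
isNeg-separates {pos} {neg} _ ()
isNeg-separates {neg} {pos} _ ()

-- countNeg counts with a function local to its definition; on a 1 × 1 matrix it is that function (up to + 0 + 0).
negEntry : Entry → ℕ
negEntry e = countNeg {1} (λ _ _ → e)

negEntry≡bit : ∀ e → negEntry e ≡ bit (isNeg e)
negEntry≡bit zer = refl
negEntry≡bit pos = refl
negEntry≡bit neg = refl

sum-map-cartesianProduct : ∀ {X Y : Set} (g : X × Y → ℕ) xs ys →
  sum (map g (cartesianProduct xs ys)) ≡ sum (map (λ x → sum (map (λ y → g (x , y)) ys)) xs)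
sum-map-cartesianProduct g [] ys = refl
sum-map-cartesianProduct g (x ∷ xs) ys = begin
  sum (map g (map (x ,_) ys ++ cartesianProduct xs ys))
    ≡⟨ cong sum (map-++ g (map (x ,_) ys) _) ⟩
  sum (map g (map (x ,_) ys) ++ map g (cartesianProduct xs ys))
    ≡⟨ sum-++ (map g (map (x ,_) ys)) _ ⟩
  sum (map g (map (x ,_) ys)) + sum (map g (cartesianProduct xs ys))
    ≡⟨ cong₂ _+_ (cong sum (sym (map-∘ ys))) (sum-map-cartesianProduct g xs ys) ⟩
  sum (map (λ y → g (x , y)) ys) + sum (map (λ x → sum (map (λ y → g (x , y)) ys)) xs)
    ∎
  where
  open ≡-Reasoning

module _ {n : ℕ} where

  positions : List (Fin n × Fin n)
  positions = cartesianProduct (allFin n) (allFin n)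

  negatives : Matrix n → Fin n × Fin n → Bool
  negatives A (i , j) = isNeg (A i j)

  countNeg≡trueCount : ∀ A → countNeg A ≡ trueCount negatives positions A
  countNeg≡trueCount A = begin
    countNeg A
      ≡⟨ cong sum (map-cong (λ i → cong sum (map-cong {g = λ j → negEntry (A i j)}
           (λ j → sym (trans (+-identityʳ _) (+-identityʳ _))) (allFin n))) (allFin n)) ⟩
    sum (map (λ i → sum (map (λ j → negEntry (A i j)) (allFin n))) (allFin n))
      ≡⟨ cong sum (map-cong (λ i → cong sum (map-cong (λ j → negEntry≡bit (A i j)) (allFin n))) (allFin n)) ⟩
    sum (map (λ i → sum (map (λ j → bit (negatives A (i , j))) (allFin n))) (allFin n))
      ≡⟨ sum-map-cartesianProduct (bit ∘ negatives A) (allFin n) (allFin n) ⟨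
    trueCount negatives positions A
      ∎
    where open ≡-Reasoning

  length-positions : length positions ≡ n * n
  length-positions = trans (length-cartesianProduct (allFin n) (allFin n))
                           (cong₂ _*_ (length-tabulate {n = n} id) (length-tabulate {n = n} id))

  -- Zero-padded to an infinite matrix.
  positivePart : Matrix n → BitMatrix
  positivePart A i j with i <? n | j <? n
  ... | yes i<n | yes j<n = isPos (A (fromℕ< i<n) (fromℕ< j<n))
  ... | _ | _ = false

  positivePart-toℕ : ∀ A i j → positivePart A (toℕ i) (toℕ j) ≡ isPos (A i j)
  positivePart-toℕ A i j with toℕ i <? n | toℕ j <? n
  ... | yes i<n | yes j<n rewrite fromℕ<-toℕ i i<n | fromℕ<-toℕ j j<n = refl
  ... | yes _ | no j≮n = ⊥-elim (j≮n (toℕ<n j))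
  ... | no i≮n | _ = ⊥-elim (i≮n (toℕ<n i))

  positivePart-true : ∀ A i j → positivePart A i j ≡ true →
    Σ (i < n) λ i<n → Σ (j < n) λ j<n → A (fromℕ< i<n) (fromℕ< j<n) ≡ pos
  positivePart-true A i j one with i <? n | j <? n
  ... | yes i<n | yes j<n = i<n , j<n , isPos-true one

module _ {n m : ℕ} (σ : Perm m) where
  open Inverse σ using (to; from; strictlyInverseˡ)

  Contains-positivePart : ∀ A → HasPattern to (positivePart A) → Contains A σ
  Contains-positivePart A (f , g , f↗ , g↗ , occ) = F , G , F↗ , G↗ , occ'
    where
    rowOf : ∀ i → Σ (f i < n) λ fi<n → Σ (g (to i) < n) λ gi<n → A (fromℕ< fi<n) (fromℕ< gi<n) ≡ pos
    rowOf i = positivePart-true A (f i) (g (to i)) (occ i)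
    g<n : ∀ j → g j < n
    g<n j = subst (λ k → g k < n) (strictlyInverseˡ j) (proj₁ (proj₂ (rowOf (from j))))
    F G : Fin m → Fin n
    F i = fromℕ< (proj₁ (rowOf i))
    G j = fromℕ< (g<n j)
    F↗ : OrderPreserving F
    F↗ {i} {j} i<j = subst₂ _<_ (sym (toℕ-fromℕ< _)) (sym (toℕ-fromℕ< _)) (f↗ i<j)
    G↗ : OrderPreserving G
    G↗ {i} {j} i<j = subst₂ _<_ (sym (toℕ-fromℕ< (g<n i))) (sym (toℕ-fromℕ< (g<n j))) (g↗ i<j)
    occ' : ∀ i → A (F i) (G (to i)) ≡ pos
    occ' i = subst (λ c → A (F i) c ≡ pos)
               (toℕ-injective (trans (toℕ-fromℕ< _) (sym (toℕ-fromℕ< (g<n (to i))))))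
               (proj₂ (proj₂ (rowOf i)))

DifferBelow-mono : ∀ {L L'} → L ≤ L' → ∀ {M M'} → DifferBelow L M M' → DifferBelow L' M M'
DifferBelow-mono L≤L' differ with find differ
... | (i , j) , ij∈ , Mij≢M'ij with ∈-grid⁻ ij∈
...   | i<L , j<L = lose (∈-grid⁺ (≤-trans i<L L≤L') (≤-trans j<L L≤L')) Mij≢M'ij

module _ {m : ℕ} (n k : ℕ) (σ : Perm m) where

  SamePositives : Matrix n → Matrix n → Set
  SamePositives = AgreeOn (entry ∘ positivePart) (grid n)

  -- Matrices with the same positive part differ in their negative entries, of which there are k.
  fibre≤ball : ∀ {A₀} → InASM n k σ A₀ → ∀ {As} → AllPairs DistinctMat As →
    All (λ A → InASM n k σ A × SamePositives A₀ A) As → length As ≤ ball (n * n) k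
  fibre≤ball {A₀} _ {As} distinct members = subst (λ L → length As ≤ ball L k) (length-positions {n})
    (length≤ball negatives positions k (AllPairs-mapWith differ members distinct)
      (All.map (λ {A} ((_ , _ , negs) , _) → ≤-reflexive (trans (sym (countNeg≡trueCount A)) negs)) members))
    where
    samePositive : ∀ {A A'} → SamePositives A₀ A → SamePositives A₀ A' → ∀ i j → isPos (A i j) ≡ isPos (A' i j)
    samePositive {A} {A'} same same' i j = begin
      isPos (A i j)                          ≡⟨ positivePart-toℕ A i j ⟨
      positivePart A (toℕ i) (toℕ j)         ≡⟨ All.lookup same ij∈ ⟨
      positivePart A₀ (toℕ i) (toℕ j)        ≡⟨ All.lookup same' ij∈ ⟩
      positivePart A' (toℕ i) (toℕ j)        ≡⟨ positivePart-toℕ A' i j ⟩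
      isPos (A' i j)                         ∎
      where
      open ≡-Reasoning
      ij∈ = ∈-grid⁺ (toℕ<n i) (toℕ<n j)
    differ : ∀ {A A'} → InASM n k σ A × SamePositives A₀ A → InASM n k σ A' × SamePositives A₀ A' →
      DistinctMat A A' → DifferOn negatives positions A A'
    differ (_ , same) (_ , same') (i , j , Aij≢A'ij) =
      lose (∈-cartesianProduct⁺ (∈-allFin i) (∈-allFin j)) (isNeg-separates Aij≢A'ij (samePositive same same' i j))

power-between : ∀ t → 2 ≤ t → ∀ n → ∃[ a ] suc n ≤ t ^ a × t ^ a ≤ t * suc n
power-between t 2≤t zero = 0 , ≤-refl , ≤-trans (≤-trans (s≤s z≤n) 2≤t) (m≤m*n t 1)
power-between t 2≤t (suc n) with power-between t 2≤t n
... | a , n<tᵃ , tᵃ≤ with suc (suc n) ≤? t ^ a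
...   | yes n+1<tᵃ = a , n+1<tᵃ , ≤-trans tᵃ≤ (*-monoʳ-≤ t (n≤1+n (suc n)))
...   | no n+1≮tᵃ = suc a , n+1<tᵃ⁺¹ , *-monoʳ-≤ t (≤-trans (≤-reflexive tᵃ≡) (n≤1+n (suc n)))
  where
  tᵃ≡ : t ^ a ≡ suc n
  tᵃ≡ = ≤-antisym (≤-pred (≰⇒> n+1≮tᵃ)) n<tᵃ
  n+1<tᵃ⁺¹ : suc (suc n) ≤ t * t ^ a
  n+1<tᵃ⁺¹ = begin
    suc (suc n)       ≤⟨ s≤s (m≤n+m (suc n) n) ⟩
    suc n + suc n     ≡⟨ cong (suc n +_) (+-identityʳ (suc n)) ⟨
    2 * suc n         ≤⟨ *-monoˡ-≤ (suc n) 2≤t ⟩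
    t * suc n         ≡⟨ cong (t *_) tᵃ≡ ⟨
    t * t ^ a         ∎
    where open ≤-Reasoning

n≤n*n : ∀ n → n ≤ n * n
n≤n*n zero = z≤n
n≤n*n (suc n) = m≤m+n (suc n) (n * suc n)

suc-square≤4^ : ∀ n → suc (n * n) ≤ 4 ^ n
suc-square≤4^ zero = ≤-refl
suc-square≤4^ (suc n) = begin
  suc (suc n * suc n)                      ≡⟨ expand n ⟩
  2 + n * n + 2 * n                        ≤⟨ +-monoʳ-≤ (2 + n * n) (*-monoʳ-≤ 2 (n≤n*n n)) ⟩
  2 + n * n + 2 * (n * n)                  ≤⟨ m≤m+n _ (2 + n * n) ⟩
  2 + n * n + 2 * (n * n) + (2 + n * n)    ≡⟨ collect n ⟩
  4 * suc (n * n)                          ≤⟨ *-monoʳ-≤ 4 (suc-square≤4^ n) ⟩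
  4 * 4 ^ n                                ∎
  where
  open ≤-Reasoning
  expand : ∀ n → suc (suc n * suc n) ≡ 2 + n * n + 2 * n
  expand = solve-∀
  collect : ∀ n → 2 + n * n + 2 * (n * n) + (2 + n * n) ≡ 4 * suc (n * n)
  collect = solve-∀

^-distribʳ-* : ∀ x y n → (x * y) ^ n ≡ x ^ n * y ^ n
^-distribʳ-* x y zero = refl
^-distribʳ-* x y (suc n) rewrite ^-distribʳ-* x y n = interchange x y (x ^ n) (y ^ n)
  where
  interchange : ∀ a b c d → a * b * (c * d) ≡ a * c * (b * d)
  interchange = solve-∀

length≤1 : ∀ {As : List (Matrix 0)} → AllPairs DistinctMat As → length As ≤ 1
length≤1 [] = z≤n
length≤1 (_ ∷ []) = ≤-refl
length≤1 (((() , _) ∷ _) ∷ _)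

Contains-empty : ∀ {n} (A : Matrix n) (σ : Perm 0) → Contains A σ
Contains-empty A σ = (λ ()) , (λ ()) , (λ { {()} }) , (λ { {()} }) , λ ()

module _ {p : ℕ} (σ : Perm (suc p)) (k : ℕ) where
  open MarcusTardos p using (t)
  open Klazar p σ using (D; D-nonZero; avoiders≤)

  ASMs≤ : ∀ n a → n ≤ t ^ a → ∀ {As} → AllPairs DistinctMat As → All (InASM n k σ) As →
    length As ≤ ball (n * n) k * D ^ t ^ a
  ASMs≤ n a n≤ distinct members
    with Fibres.length≤fibre*representatives DistinctMat (SamePositives n k σ)
           (DifferOn (entry ∘ positivePart) (grid n)) (agree-or-differ (entry ∘ positivePart) (grid n))
           (λ _ → All.universal (λ _ → refl) (grid n)) (InASM n k σ) (ball (n * n) k)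
           (λ {A₀} → fibre≤ball n k σ {A₀}) id distinct members
  ... | reps , apart , reps-members , bound = ≤-trans bound (*-monoʳ-≤ (ball (n * n) k) reps≤)
    where
    reps≤ : length reps ≤ D ^ t ^ a
    reps≤ = subst (_≤ D ^ t ^ a) (length-map positivePart reps)
      (avoiders≤ a (AllPairs.map⁺ (AllPairs.map (DifferBelow-mono n≤) apart))
        (All.map⁺ (All.map (λ {A} (_ , avoid , _) → avoid ∘ Contains-positivePart σ A) reps-members)))

  ASMs≤exponential : ∀ n {As} → AllPairs DistinctMat As → All (InASM n k σ) As → length As ≤ (4 ^ k * D ^ t) ^ n
  ASMs≤exponential zero distinct _ = length≤1 distinct
  ASMs≤exponential n@(suc n') {As} distinct members with power-between t (s≤s (s≤s z≤n)) n'
  ... | a , n≤tᵃ , tᵃ≤tn = begin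
    length As                          ≤⟨ ASMs≤ n a n≤tᵃ distinct members ⟩
    ball (n * n) k * D ^ t ^ a         ≤⟨ *-mono-≤ (ball≤suc^ (n * n) k) (^-monoʳ-≤ D tᵃ≤tn) ⟩
    suc (n * n) ^ k * D ^ (t * n)      ≤⟨ *-monoˡ-≤ (D ^ (t * n)) (^-monoˡ-≤ k (suc-square≤4^ n)) ⟩
    (4 ^ n) ^ k * D ^ (t * n)          ≡⟨ cong₂ _*_ (^-*-assoc 4 n k) (sym (^-*-assoc D t n)) ⟩
    4 ^ (n * k) * (D ^ t) ^ n          ≡⟨ cong (λ e → 4 ^ e * (D ^ t) ^ n) (*-comm n k) ⟩
    4 ^ (k * n) * (D ^ t) ^ n          ≡⟨ cong (_* (D ^ t) ^ n) (^-*-assoc 4 k n) ⟨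
    (4 ^ k) ^ n * (D ^ t) ^ n          ≡⟨ ^-distribʳ-* (4 ^ k) (D ^ t) n ⟨
    (4 ^ k * D ^ t) ^ n                ∎
    where open ≤-Reasoning

theorem1p2 : ∀ {m} (σ : Perm m) (k : ℕ) →
    ∃[ c ] ∀ (n : ℕ) (As : List (Matrix n)) →
      AllPairs DistinctMat As → All (InASM n k σ) As → length As ≤ c ^ n
theorem1p2 {zero} σ k = 1 , λ where
  n [] _ _ → z≤n
  n (A ∷ _) _ ((_ , avoid , _) ∷ _) → ⊥-elim (avoid (Contains-empty A σ))
theorem1p2 {suc p} σ k = 4 ^ k * D ^ t , λ n As → ASMs≤exponential σ k n
  where
  open MarcusTardos p using (t)
  open Klazar p σ using (D)
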